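{- Let $n,k$ be integers with $k\ge1$, $n>2k$. Let $m$ be a positive integer with $m<k$, and let $r\in\{0,\dots,m-1\}$ with $r\equiv k\pmod m$, and suppose $m>2r>0$. Then (a) if $m\mid n$, $\beta(P(n,k))\le \frac{n}{m}\,\beta(P(m,r))$; (b) if $m\nmid n$, $\beta(P(n,k))\le \left\lfloor\frac{n}{m}\right\rfloor\beta(P(m,r))+2k$.
   Context: For integers $N>2K\ge 2$, $P(N,K)$ is the generalized Petersen graph with vertices $u_1,\dots,u_N,v_1,\dots,v_N$ and edges $u_iu_{i+1}$, $u_iv_i$, $v_iv_{i+K}$ (subscripts modulo $N$). $\beta(G)$ denotes the size of a minimum vertex cover of $G$. -}

module Defs where

open import Data.Nat using (ℕ; zero; suc; _+_; _≤_)
open import Data.Nat.DivMod using (_mod_)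
open import Data.Fin using (Fin; toℕ; _↑ˡ_; _↑ʳ_)
open import Data.Fin.Subset using (Subset; _∈_; ∣_∣)
open import Data.Sum using (_⊎_)
open import Data.Product using (_×_; ∃)
open import Relation.Binary.PropositionalEquality using (_≡_)

record Graph : Set₁ where
  field
    V    : ℕ
    Edge : Fin V → Fin V → Set

open Graph public

IsVertexCover : (G : Graph) → Subset (V G) → Set
IsVertexCover G S = ∀ x y → Edge G x y → (x ∈ S) ⊎ (y ∈ S)

IsVertexCoverNumber : Graph → ℕ → Set
IsVertexCoverNumber G b =
  (∃ λ S → IsVertexCover G S × ∣ S ∣ ≡ b) × (∀ S → IsVertexCover G S → b ≤ ∣ S ∣)

shift : ∀ {N} → Fin N → ℕ → Fin N
shift {suc N} i j = (toℕ i + j) mod (suc N)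

-- Vertices of P(N,K): u_i = i, v_i = N + i, on Fin (N + N) (0-based indices).
u : ∀ {N} → Fin N → Fin (N + N)
u {N} i = i ↑ˡ N

v : ∀ {N} → Fin N → Fin (N + N)
v {N} i = N ↑ʳ i

data PEdge (N K : ℕ) : Fin (N + N) → Fin (N + N) → Set where
  outer : ∀ (i : Fin N) → PEdge N K (u i) (u (shift i 1))
  spoke : ∀ (i : Fin N) → PEdge N K (u i) (v i)
  inner : ∀ (i : Fin N) → PEdge N K (v i) (v (shift i K))
  sym   : ∀ {x y} → PEdge N K x y → PEdge N K y x

P : ℕ → ℕ → Graph
P N K = record { V = N + N ; Edge = PEdge N K }

module Submission where

-- Write n = q·m + s with s = n mod m, and let S be a minimum vertex
-- cover of P(m,r).  Lift S periodically to P(n,k): take u_i (resp. v_i) whenever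
-- u_{i mod m} (resp. v_{i mod m}) lies in S.  Since k ≡ r (mod m), an outer edge
-- u_i u_{i+1} or an inner edge v_i v_{i+k} of P(n,k) is carried by i ↦ i mod m onto
-- an edge of P(m,r), hence covered -- unless it wraps around modulo n while m ∤ n.
-- Such edges are repaired by also taking every u_i with i ≥ A and every v_i with
-- i ≥ B; the choice A = B = n works when m ∣ n, and A = q·m, B = n − k otherwise.

open import Defs
open import Data.Nat using (ℕ; _+_; _*_; _≤_; _<_; NonZero)
open import Data.Nat.DivMod using (_/_; _%_)
open import Data.Nat.Divisibility using (_∣_)
open import Data.Product using (_×_)
open import Relation.Binary.PropositionalEquality using (_≡_)
open import Relation.Nullary using (¬_)

open import Function using (_∘_; id)
open import Data.Bool using (Bool; true; false; _∨_)
open import Data.Bool.Properties using (∨-zeroʳ)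
open import Data.Nat using (zero; suc; _∸_; z≤n; z<s; s<s; _≤?_; _<?_; >-nonZero)
open import Data.Nat.Properties
open import Data.Nat.DivMod using (_mod_; m<n⇒m%n≡m; m%n<n; %-distribˡ-+; m%n%n≡m%n; [m+n]%n≡m%n; m∣n⇒o%n%m≡o%m; m≡m%n+[m/n]*n)
open import Data.Nat.Divisibility using (m%n≡0⇒n∣m; n∣m⇒m%n≡0)
open import Data.Nat.Solver using (module +-*-Solver)
open import Data.Fin using (Fin; toℕ)
open import Data.Fin.Properties using (toℕ-injective; toℕ-fromℕ<; toℕ<n)
open import Data.Fin.Subset using (Subset; _∈_; ∣_∣)
open import Data.Vec using ([]; _∷_; _++_; lookup; tabulate; splitAt)
open import Data.Vec.Properties using (lookup-++ˡ; lookup-++ʳ; lookup∘tabulate; tabulate∘lookup; tabulate-cong; []=⇒lookup; lookup⇒[]=)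
open import Data.Product using (_,_)
open import Data.Sum using (_⊎_; inj₁; inj₂; swap) renaming (map to ⊎-map)
open import Relation.Binary.PropositionalEquality using (refl; trans; cong; cong₂; subst; module ≡-Reasoning)
open import Relation.Nullary using (yes; no; does)
open import Relation.Nullary.Decidable using (dec-true; dec-false)
open import Relation.Binary.PropositionalEquality using () renaming (sym to ≡-sym)

-- (1) Counting.

indicator : Bool → ℕ
indicator true  = 1
indicator false = 0

count : (ℕ → Bool) → ℕ → ℕ
count g zero    = 0
count g (suc N) = indicator (g 0) + count (g ∘ suc) N

count-cong : ∀ N {f g : ℕ → Bool} → (∀ j → j < N → f j ≡ g j) → count f N ≡ count g N
count-cong zero    eq = refl
count-cong (suc N) eq =
  cong₂ _+_ (cong indicator (eq 0 z<s)) (count-cong N (λ j j<N → eq (suc j) (s<s j<N)))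

count-+ : ∀ a b g → count g (a + b) ≡ count g a + count (λ j → g (a + j)) b
count-+ zero    b g = refl
count-+ (suc a) b g =
  trans (cong (indicator (g 0) +_) (count-+ a b (g ∘ suc))) (≡-sym (+-assoc (indicator (g 0)) _ _))

count-≤ : ∀ N g → count g N ≤ N
count-≤ zero    g = z≤n
count-≤ (suc N) g = +-mono-≤ (indicator≤1 (g 0)) (count-≤ N (g ∘ suc))
  where
    indicator≤1 : ∀ b → indicator b ≤ 1
    indicator≤1 true  = ≤-refl
    indicator≤1 false = z≤n

count-mono : ∀ g {a b} → a ≤ b → count g a ≤ count g b
count-mono g {a} {b} a≤b = begin
    count g a                                   ≤⟨ m≤m+n _ _ ⟩
    count g a + count (λ j → g (a + j)) (b ∸ a) ≡⟨ count-+ a (b ∸ a) g ⟨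
    count g (a + (b ∸ a))                       ≡⟨ cong (count g) (m+[n∸m]≡n a≤b) ⟩
    count g b                                   ∎
  where open ≤-Reasoning

count-periodic : ∀ q m g → (∀ j → g (m + j) ≡ g j) → count g (q * m) ≡ q * count g m
count-periodic zero    m g per = refl
count-periodic (suc q) m g per =
  trans (count-+ m (q * m) g)
        (cong (count g m +_) (trans (count-cong (q * m) (λ j _ → per j)) (count-periodic q m g per)))

count-threshold : ∀ {A N} g → A ≤ N → count (λ j → does (A ≤? j) ∨ g j) N ≤ count g A + (N ∸ A)
count-threshold {A} {N} g A≤N = begin
    count h N                                   ≡⟨ cong (count h) (m+[n∸m]≡n A≤N) ⟨
    count h (A + (N ∸ A))                       ≡⟨ count-+ A (N ∸ A) h ⟩
    count h A + count (λ j → h (A + j)) (N ∸ A) ≤⟨ +-mono-≤ (≤-reflexive below-A) (count-≤ (N ∸ A) _) ⟩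
    count g A + (N ∸ A)                         ∎
  where
    open ≤-Reasoning
    h : ℕ → Bool
    h j = does (A ≤? j) ∨ g j
    below-A : count h A ≡ count g A
    below-A = count-cong A (λ j j<A → cong (_∨ g j) (dec-false (A ≤? j) (<⇒≱ j<A)))

-- (2) Subsets of Fin (N + N), whose first half holds the u's and second half the v's.

layered : ∀ N → (ℕ → Bool) → (ℕ → Bool) → Subset (N + N)
layered N f g = tabulate {n = N} (f ∘ toℕ) ++ tabulate {n = N} (g ∘ toℕ)

lookup-layered-u : ∀ {N} f g (i : Fin N) → lookup (layered N f g) (u i) ≡ f (toℕ i)
lookup-layered-u {N} f g i =
  trans (lookup-++ˡ (tabulate {n = N} (f ∘ toℕ)) (tabulate {n = N} (g ∘ toℕ)) i) (lookup∘tabulate (f ∘ toℕ) i)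

lookup-layered-v : ∀ {N} f g (i : Fin N) → lookup (layered N f g) (v i) ≡ g (toℕ i)
lookup-layered-v {N} f g i =
  trans (lookup-++ʳ (tabulate {n = N} (f ∘ toℕ)) (tabulate {n = N} (g ∘ toℕ)) i) (lookup∘tabulate (g ∘ toℕ) i)

∣++∣ : ∀ {a b} (xs : Subset a) (ys : Subset b) → ∣ xs ++ ys ∣ ≡ ∣ xs ∣ + ∣ ys ∣
∣++∣ []           ys = refl
∣++∣ (true ∷ xs)  ys = cong suc (∣++∣ xs ys)
∣++∣ (false ∷ xs) ys = ∣++∣ xs ys

∣tabulate∣ : ∀ N g → ∣ tabulate {n = N} (g ∘ toℕ) ∣ ≡ count g N
∣tabulate∣ zero    g = refl
∣tabulate∣ (suc N) g =
  ∣cons∣ (g 0) {xs = tabulate (g ∘ suc ∘ toℕ)} (cong (indicator (g 0) +_) (∣tabulate∣ N (g ∘ suc)))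
  where
    ∣cons∣ : ∀ b {xs : Subset N} {c} → indicator b + ∣ xs ∣ ≡ c → ∣ b ∷ xs ∣ ≡ c
    ∣cons∣ true  eq = eq
    ∣cons∣ false eq = eq

∣layered∣ : ∀ N f g → ∣ layered N f g ∣ ≡ count f N + count g N
∣layered∣ N f g = trans (∣++∣ (tabulate {n = N} (f ∘ toℕ)) (tabulate {n = N} (g ∘ toℕ)))
                        (cong₂ _+_ (∣tabulate∣ N f) (∣tabulate∣ N g))

toℕ-mod : ∀ a M .{{_ : NonZero M}} → toℕ (a mod M) ≡ a % M
toℕ-mod a M = toℕ-fromℕ< (m%n<n a M)

mod-toℕ : ∀ {M} .{{_ : NonZero M}} (i : Fin M) → toℕ i mod M ≡ i
mod-toℕ {M} i = toℕ-injective (trans (toℕ-mod (toℕ i) M) (m<n⇒m%n≡m (toℕ<n i)))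

mod-periodic : ∀ M .{{_ : NonZero M}} j → (M + j) mod M ≡ j mod M
mod-periodic M j = toℕ-injective (begin
    toℕ ((M + j) mod M) ≡⟨ toℕ-mod (M + j) M ⟩
    (M + j) % M         ≡⟨ cong (_% M) (+-comm M j) ⟩
    (j + M) % M         ≡⟨ [m+n]%n≡m%n j M ⟩
    j % M               ≡⟨ toℕ-mod j M ⟨
    toℕ (j mod M)       ∎)
  where open ≡-Reasoning

module PeriodicReading {M : ℕ} .{{_ : NonZero M}} (S : Subset (M + M)) where

  outer-S : ℕ → Bool
  outer-S j = lookup S (u (j mod M))

  inner-S : ℕ → Bool
  inner-S j = lookup S (v (j mod M))

  layered-readings : layered M outer-S inner-S ≡ S
  layered-readings with splitAt M S
  ... | ys , zs , refl = cong₂ _++_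
    (trans (tabulate-cong (λ i → trans (cong (λ x → lookup (ys ++ zs) (u x)) (mod-toℕ {M} i)) (lookup-++ˡ ys zs i)))
           (tabulate∘lookup ys))
    (trans (tabulate-cong (λ i → trans (cong (λ x → lookup (ys ++ zs) (v x)) (mod-toℕ {M} i)) (lookup-++ʳ ys zs i)))
           (tabulate∘lookup zs))

  full-periods : ∀ q → count outer-S (q * M) + count inner-S (q * M) ≡ q * ∣ S ∣
  full-periods q = begin
      count outer-S (q * M) + count inner-S (q * M)
        ≡⟨ cong₂ _+_ (count-periodic q M outer-S (λ j → cong (λ x → lookup S (u x)) (mod-periodic M j)))
                     (count-periodic q M inner-S (λ j → cong (λ x → lookup S (v x)) (mod-periodic M j))) ⟩
      q * count outer-S M + q * count inner-S M ≡⟨ *-distribˡ-+ q _ _ ⟨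
      q * (count outer-S M + count inner-S M)   ≡⟨ cong (q *_) (∣layered∣ M outer-S inner-S) ⟨
      q * ∣ layered M outer-S inner-S ∣         ≡⟨ cong (λ T → q * ∣ T ∣) layered-readings ⟩
      q * ∣ S ∣                                 ∎
    where open ≡-Reasoning

-- (3) When does an edge of P(n,k) project onto an edge of P(m,r)?

mod-step : ∀ a {d d'} m .{{_ : NonZero m}} → d % m ≡ d' % m → (a + d) % m ≡ (a % m + d') % m
mod-step a {d} {d'} m d≡d' = begin
    (a + d) % m              ≡⟨ %-distribˡ-+ a d m ⟩
    (a % m + d % m) % m      ≡⟨ cong (λ z → (a % m + z) % m) d≡d' ⟩
    (a % m + d' % m) % m     ≡⟨ cong (λ z → (z + d' % m) % m) (m%n%n≡m%n a m) ⟨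
    (a % m % m + d' % m) % m ≡⟨ %-distribˡ-+ (a % m) d' m ⟨
    (a % m + d') % m         ∎
  where open ≡-Reasoning

-- The step a ↦ a + d in ℤ/n, read modulo m, is the step a mod m ↦ a mod m + d' in ℤ/m.
Compatible : ∀ n m .{{_ : NonZero n}} .{{_ : NonZero m}} → (d d' a : ℕ) → Set
Compatible n m d d' a = (a + d) % n % m ≡ (a % m + d') % m

-- When m ∣ n, reduction modulo n does not disturb residues modulo m.
compatible-if-divides : ∀ {n m} .{{_ : NonZero n}} .{{_ : NonZero m}} {d d'} →
  m ∣ n → d % m ≡ d' % m → ∀ a → Compatible n m d d' a
compatible-if-divides {n} {m} m∣n d≡d' a =
  trans (m∣n⇒o%n%m≡o%m m n (a + _) m∣n) (mod-step a m d≡d')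

-- In general only the steps that wrap around modulo n, i.e. a ≥ n − d, can fail.
compatible-or-wraps : ∀ {n m} .{{_ : NonZero n}} .{{_ : NonZero m}} {d d'} →
  d % m ≡ d' % m → ∀ a → n ∸ d ≤ a ⊎ Compatible n m d d' a
compatible-or-wraps {n} {m} {d} d≡d' a with a + d <? n
... | yes a+d<n = inj₂ (trans (cong (_% m) (m<n⇒m%n≡m a+d<n)) (mod-step a m d≡d'))
... | no  a+d≮n = inj₁ (≤-trans (∸-monoˡ-≤ d (≮⇒≥ a+d≮n)) (≤-reflexive (m+n∸n≡m a d)))

toℕ-shift : ∀ {N} .{{_ : NonZero N}} (i : Fin N) d → toℕ (shift i d) ≡ (toℕ i + d) % N
toℕ-shift {suc N} i d = toℕ-mod (toℕ i + d) (suc N)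

shift-project : ∀ {n m} .{{_ : NonZero n}} .{{_ : NonZero m}} {d d'} (i : Fin n) →
  Compatible n m d d' (toℕ i) → toℕ (shift i d) mod m ≡ shift (toℕ i mod m) d'
shift-project {n} {m} {d} {d'} i compatible = toℕ-injective (begin
    toℕ (toℕ (shift i d) mod m)          ≡⟨ toℕ-mod (toℕ (shift i d)) m ⟩
    toℕ (shift i d) % m                  ≡⟨ cong (_% m) (toℕ-shift i d) ⟩
    (toℕ i + d) % n % m                  ≡⟨ compatible ⟩
    (toℕ i % m + d') % m                 ≡⟨ cong (λ z → (z + d') % m) (toℕ-mod (toℕ i) m) ⟨
    (toℕ (toℕ i mod m) + d') % m         ≡⟨ toℕ-shift (toℕ i mod m) d' ⟨
    toℕ (shift (toℕ i mod m) d')         ∎)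
  where open ≡-Reasoning

-- (4) The lifted cover.

∨-true : ∀ b {c} → c ≡ true → b ∨ c ≡ true
∨-true b refl = ∨-zeroʳ b

module Lifting (n k m r : ℕ) .{{_ : NonZero n}} .{{_ : NonZero m}} (S : Subset (m + m)) where
  open PeriodicReading S

  lifted-outer lifted-inner : ℕ → ℕ → Bool
  lifted-outer A j = does (A ≤? j) ∨ outer-S j
  lifted-inner B j = does (B ≤? j) ∨ inner-S j

  lift : ℕ → ℕ → Subset (n + n)
  lift A B = layered n (lifted-outer A) (lifted-inner B)

  LiftsAlong : (∀ {N} → Fin N → Fin (N + N)) → Subset (n + n) → ℕ → Set
  LiftsAlong w T t = ∀ (j : Fin n) → lookup T (w j) ≡ does (t ≤? toℕ j) ∨ lookup S (w (toℕ j mod m))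

  module _ (w : ∀ {N} → Fin N → Fin (N + N)) {T t} (lifts : LiftsAlong w T t) where

    beyond : ∀ (j : Fin n) → t ≤ toℕ j → w j ∈ T
    beyond j t≤j = lookup⇒[]= (w j) T (trans (lifts j) (cong (_∨ _) (dec-true (t ≤? toℕ j) t≤j)))

    inherited : ∀ (j : Fin n) → w (toℕ j mod m) ∈ S → w j ∈ T
    inherited j w∈S = lookup⇒[]= (w j) T (trans (lifts j) (∨-true _ ([]=⇒lookup w∈S)))

    layer-edge : ∀ {d d'} (i : Fin n) → t ≤ toℕ i ⊎ Compatible n m d d' (toℕ i) →
      w (toℕ i mod m) ∈ S ⊎ w (shift (toℕ i mod m) d') ∈ S → w i ∈ T ⊎ w (shift i d) ∈ T
    layer-edge i (inj₁ t≤i)        _           = inj₁ (beyond i t≤i)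
    layer-edge i (inj₂ _)          (inj₁ w∈S)  = inj₁ (inherited i w∈S)
    layer-edge i (inj₂ compatible) (inj₂ w∈S)  =
      inj₂ (inherited _ (subst (λ x → w x ∈ S) (≡-sym (shift-project i compatible)) w∈S))

  lift-cover : ∀ A B → IsVertexCover (P m r) S →
    (∀ a → A ≤ a ⊎ Compatible n m 1 1 a) → (∀ a → B ≤ a ⊎ Compatible n m k r a) →
    IsVertexCover (P n k) (lift A B)
  lift-cover A B cover outer-ok inner-ok _ _ = covered
    where
      along-u : LiftsAlong u (lift A B) A
      along-u = lookup-layered-u (lifted-outer A) (lifted-inner B)
      along-v : LiftsAlong v (lift A B) B
      along-v = lookup-layered-v (lifted-outer A) (lifted-inner B)
      covered : ∀ {x y} → PEdge n k x y → x ∈ lift A B ⊎ y ∈ lift A B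
      covered (outer i) = layer-edge u along-u i (outer-ok (toℕ i)) (cover _ _ (outer (toℕ i mod m)))
      covered (inner i) = layer-edge v along-v i (inner-ok (toℕ i)) (cover _ _ (inner (toℕ i mod m)))
      covered (spoke i) =
        ⊎-map (inherited u {t = A} along-u i) (inherited v {t = B} along-v i) (cover _ _ (spoke (toℕ i mod m)))
      covered (sym e)   = swap (covered e)

  lift-size : ∀ {A B} → A ≤ n → B ≤ n →
    ∣ lift A B ∣ ≤ (count outer-S A + (n ∸ A)) + (count inner-S B + (n ∸ B))
  lift-size A≤n B≤n = ≤-trans (≤-reflexive (∣layered∣ n _ _))
                              (+-mono-≤ (count-threshold outer-S A≤n) (count-threshold inner-S B≤n))

-- (5) The two cases of the theorem, for a vertex cover S of P(m,r).

divisible-bound : ∀ n k m r .{{_ : NonZero n}} .{{_ : NonZero m}} → k % m ≡ r % m → m ∣ n →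
  ∀ S → IsVertexCover (P m r) S → ∀ b → (∀ T → IsVertexCover (P n k) T → b ≤ ∣ T ∣) →
  b ≤ (n / m) * ∣ S ∣
divisible-bound n k m r k≡r m∣n S cover b minimal = begin
    b
      ≤⟨ minimal _ lift-is-cover ⟩
    ∣ lift n n ∣
      ≤⟨ lift-size ≤-refl ≤-refl ⟩
    (count outer-S n + (n ∸ n)) + (count inner-S n + (n ∸ n))
      ≡⟨ cong₂ _+_ (drop-empty outer-S) (drop-empty inner-S) ⟩
    count outer-S n + count inner-S n
      ≡⟨ cong (λ N → count outer-S N + count inner-S N) n≡q*m ⟩
    count outer-S (q * m) + count inner-S (q * m)
      ≡⟨ full-periods q ⟩
    q * ∣ S ∣
      ∎
  where
    open ≤-Reasoning
    open Lifting n k m r S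
    open PeriodicReading S
    q : ℕ
    q = n / m
    -- Every step is compatible, so no threshold vertices are needed.
    no-wrap : ∀ {A d d'} → d % m ≡ d' % m → ∀ a → A ≤ a ⊎ Compatible n m d d' a
    no-wrap d≡d' a = inj₂ (compatible-if-divides m∣n d≡d' a)
    n≡q*m : n ≡ q * m
    n≡q*m = trans (m≡m%n+[m/n]*n n m) (cong (_+ q * m) (n∣m⇒m%n≡0 n m m∣n))
    lift-is-cover : IsVertexCover (P n k) (lift n n)
    lift-is-cover = lift-cover n n cover (no-wrap refl) (no-wrap k≡r)
    drop-empty : ∀ g → count g n + (n ∸ n) ≡ count g n
    drop-empty g = trans (cong (count g n +_) (n∸n≡0 n)) (+-identityʳ _)

-- Part (b): if m ∤ n, write n = s + q·m with 0 < s < m.  The thresholds A = q·m and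
-- B = n − k repair the wrapping edges, at the cost of s ≤ k outer and k inner vertices.
nondivisible-bound : ∀ n k m r .{{_ : NonZero n}} .{{_ : NonZero m}} → k % m ≡ r % m →
  m < k → k ≤ n → ¬ (m ∣ n) →
  ∀ S → IsVertexCover (P m r) S → ∀ b → (∀ T → IsVertexCover (P n k) T → b ≤ ∣ T ∣) →
  b ≤ (n / m) * ∣ S ∣ + 2 * k
nondivisible-bound n k m r k≡r m<k k≤n m∤n S cover b minimal = begin
    b
      ≤⟨ minimal _ lift-is-cover ⟩
    ∣ lift A B ∣
      ≤⟨ lift-size (<⇒≤ A<n) (m∸n≤m n k) ⟩
    (count outer-S A + (n ∸ A)) + (count inner-S B + (n ∸ B))
      ≤⟨ +-mono-≤ (+-monoʳ-≤ (count outer-S A) n∸A≤k)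
                  (+-mono-≤ (count-mono inner-S B≤A) (≤-reflexive (m∸[m∸n]≡n k≤n))) ⟩
    (count outer-S A + k) + (count inner-S A + k)
      ≡⟨ regroup (count outer-S A) (count inner-S A) k ⟩
    (count outer-S A + count inner-S A) + 2 * k
      ≡⟨ cong (_+ 2 * k) (full-periods q) ⟩
    q * ∣ S ∣ + 2 * k
      ∎
  where
    open ≤-Reasoning
    open Lifting n k m r S
    open PeriodicReading S
    q s A B : ℕ
    q = n / m
    s = n % m
    A = q * m
    B = n ∸ k
    n≡s+A : n ≡ s + A
    n≡s+A = m≡m%n+[m/n]*n n m
    s≤k : s ≤ k
    s≤k = <⇒≤ (<-trans (m%n<n n m) m<k)
    n∸A≤k : n ∸ A ≤ k
    n∸A≤k = ≤-trans (≤-reflexive (trans (cong (_∸ A) n≡s+A) (m+n∸n≡m s A))) s≤k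
    -- s ≠ 0 because m ∤ n.
    A<n : A < n
    A<n = subst (A <_) (≡-sym n≡s+A) (m<n+m A (n≢0⇒n>0 (m∤n ∘ m%n≡0⇒n∣m n m)))
    B≤A : B ≤ A
    B≤A = ≤-trans (∸-monoʳ-≤ n s≤k) (≤-reflexive (trans (cong (_∸ s) n≡s+A) (m+n∸m≡n s A)))
    -- Wrapping outer edges start at n − 1 ≥ A, wrapping inner edges at n − k = B.
    outer-ok : ∀ a → A ≤ a ⊎ Compatible n m 1 1 a
    outer-ok a = ⊎-map (≤-trans (∸-monoˡ-≤ 1 A<n)) id (compatible-or-wraps {n} {m} refl a)
    inner-ok : ∀ a → B ≤ a ⊎ Compatible n m k r a
    inner-ok = compatible-or-wraps {n} {m} k≡r
    lift-is-cover : IsVertexCover (P n k) (lift A B)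
    lift-is-cover = lift-cover A B cover outer-ok inner-ok
    regroup : ∀ x y z → (x + z) + (y + z) ≡ (x + y) + 2 * z
    regroup = solve 3 (λ x y z → (x :+ z) :+ (y :+ z) := (x :+ y) :+ con 2 :* z) refl
      where open +-*-Solver

-- Apply the two bounds to a minimum cover S of P(m,r).
theorem11 : (n k m r : ℕ) .{{_ : NonZero m}} →
    1 ≤ k → 2 * k < n → m < k → r < m → r % m ≡ k % m → 0 < 2 * r → 2 * r < m →
    (b c : ℕ) → IsVertexCoverNumber (P n k) b → IsVertexCoverNumber (P m r) c →
    (m ∣ n → b ≤ (n / m) * c) × (¬ (m ∣ n) → b ≤ (n / m) * c + 2 * k)
theorem11 n k m r _ 2k<n m<k _ r≡k _ _ b c (_ , minimal) ((S , cover , ∣S∣≡c) , _) =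
    (λ m∣n → subst (λ x → b ≤ (n / m) * x) ∣S∣≡c
               (divisible-bound n k m r k≡r m∣n S cover b minimal))
  , (λ m∤n → subst (λ x → b ≤ (n / m) * x + 2 * k) ∣S∣≡c
               (nondivisible-bound n k m r k≡r m<k k≤n m∤n S cover b minimal))
  where
    instance
      n-nonZero : NonZero n
      n-nonZero = >-nonZero (<-≤-trans z<s 2k<n)
    k≡r : k % m ≡ r % m
    k≡r = ≡-sym r≡k
    k≤n : k ≤ n
    k≤n = ≤-trans (m≤m+n k (k + 0)) (<⇒≤ 2k<n)
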